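{- For every integer $n \geq 1$, the number of increasing 1,2-trees with $n$ vertices is $n^{n-2}$.
   Context: Increasing 1,2-trees are labeled graphs defined inductively: the only increasing 1,2-tree with one vertex is the isolated vertex labeled $1$; given an increasing 1,2-tree $T$ with $n$ vertices (labeled $1,\dots,n$), one obtains an increasing 1,2-tree with $n+1$ vertices by choosing either a vertex of $T$ or an edge of $T$ and adding a new vertex labeled $n+1$ adjacent to the chosen vertex, respectively to both endpoints of the chosen edge. Two increasing 1,2-trees are the same if they are equal as labeled graphs. -}

module Defs where

open import Data.Nat using (ℕ; suc)
open import Data.Bool using (Bool; true; false)
open import Data.Fin using (Fin)
open import Data.Fin.Properties using (_≟_)
open import Data.Vec using (Vec; []; _∷_; _∷ʳ_; zipWith; tabulate; lookup)
open import Relation.Nullary.Decidable using (⌊_⌋)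
open import Relation.Binary.PropositionalEquality using (_≡_)
open import Data.Bool using (_∨_)

-- A labeled (simple) graph on vertex set {1,…,n}, encoded as its adjacency
-- matrix; index i : Fin n stands for the vertex labeled (toℕ i + 1).
Adj : ℕ → Set
Adj n = Vec (Vec Bool n) n

extend : {n : ℕ} → Adj n → Vec Bool n → Adj (suc n)
extend A nb = zipWith (λ row b → row ∷ʳ b) A nb ∷ʳ (nb ∷ʳ false)

single : {n : ℕ} → Fin n → Vec Bool n
single v = tabulate (λ w → ⌊ w ≟ v ⌋)

pair : {n : ℕ} → Fin n → Fin n → Vec Bool n
pair u v = tabulate (λ w → ⌊ w ≟ u ⌋ ∨ ⌊ w ≟ v ⌋)

adj : {n : ℕ} → Adj n → Fin n → Fin n → Bool
adj A u v = lookup (lookup A u) v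

data Inc12 : (n : ℕ) → Adj n → Set where
  base     : Inc12 1 ((false ∷ []) ∷ [])
  onVertex : {n : ℕ} {A : Adj n} → Inc12 n A → (v : Fin n) →
             Inc12 (suc n) (extend A (single v))
  onEdge   : {n : ℕ} {A : Adj n} → Inc12 n A → (u v : Fin n) →
             adj A u v ≡ true → Inc12 (suc n) (extend A (pair u v))

-- An increasing 1,2-tree with n vertices and e edges has n + e children: n of them (new
-- vertex attached to a vertex) have e + 1 edges, e of them (attached to an edge) have e + 2.
-- Generating the trees level by level, each carrying a list of its edges, produces every tree
-- exactly once, since the adjacency matrix of a child determines both its parent and the
-- neighbourhood of the new vertex.  So the number D n e d of trees with n + d vertices grown
-- from one with n vertices and e edges satisfies D n e (d + 1) = n D (n+1) (e+1) d +
-- e D (n+1) (e+2) d, and the count sought is D 1 0 (n - 1).  With N = n + d, D n e d = H N d (e - 1)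
-- because besides its defining recurrence H satisfies the difference equation
-- H N (d + 1) (j + 1) = H N (d + 1) j + (d + 1) H N d (j + 1); and H N d 0 = N ^ d.
module Submission where

open import Defs
open import Data.Nat using (ℕ; zero; suc; _+_; _*_; _≤_; _^_; _∸_)
import Data.Nat as ℕ
open import Data.Nat.Properties using (+-identityʳ; *-identityˡ; *-identityʳ; +-suc; +-cancelʳ-≡)
open import Data.Nat.ListAction using (sum)
open import Data.Nat.ListAction.Properties using (sum-++)
open import Data.Nat.Tactic.RingSolver using (solve-∀)
open import Data.Bool using (Bool; true; false; _∨_)
open import Data.Bool.Properties using (∨-comm)
open import Data.Fin using (Fin; zero; suc; toℕ; inject₁; fromℕ; _<_)
open import Data.Fin.Properties
  using (_≟_; <⇒≢; <-asym; inject₁-injective; fromℕ≢inject₁; toℕ-inject₁; toℕ-fromℕ; inject₁ℕ<)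
open import Data.Vec using (Vec; []; _∷_; _∷ʳ_; zipWith; lookup)
open import Data.Vec.Properties
  using (∷ʳ-injective; ∷ʳ-injectiveˡ; ∷-injective; lookup-zipWith; lookup∘tabulate; tabulate-cong)
open import Data.List using (List; []; _∷_; _++_; map; concatMap; allFin; length)
open import Data.List.Properties using (map-++; map-∘; map-concatMap; length-map; length-tabulate)
open import Data.List.Relation.Unary.All as All using (All; []; _∷_)
open import Data.List.Relation.Unary.All.Properties as All using ()
open import Data.List.Relation.Unary.AllPairs using ([]; _∷_)
open import Data.List.Relation.Unary.Any using (here; there)
open import Data.List.Relation.Unary.Unique.Propositional using (Unique)
open import Data.List.Relation.Unary.Unique.Propositional.Properties using (map⁺; ++⁺; allFin⁺)
open import Data.List.Relation.Binary.Disjoint.Propositional using (Disjoint)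
open import Data.List.Membership.Propositional using (_∈_; lose; find)
open import Data.List.Membership.Propositional.Properties
  using (∈-map⁺; ∈-map⁻; ∈-++⁺ˡ; ∈-++⁺ʳ; ∈-++⁻; ∈-allFin; ∈-concatMap⁺; ∈-concatMap⁻)
open import Data.Product using (Σ; ∃; _×_; _,_; proj₁; proj₂; uncurry)
open import Data.Sum as Sum using (_⊎_; inj₁; inj₂)
open import Function using (_∘_)
open import Function.Bundles using (_⇔_; mk⇔; Equivalence)
open import Relation.Nullary using (yes; no; contradiction)
open import Relation.Nullary.Decidable using (⌊_⌋)
open import Relation.Binary.PropositionalEquality
  using (_≡_; _≢_; refl; sym; trans; cong; cong₂; subst; subst₂; module ≡-Reasoning)

open Equivalence using (to; from)

private variable
  n : ℕ
  X Y : Set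

-- Descendant counts

-- H N d j = Σₖ (d choose k) N^(d-k) j(j+1)⋯(j+k-1), i.e. (N + j·shift)^d applied to 1.
H : ℕ → ℕ → ℕ → ℕ
H N zero    j = 1
H N (suc d) j = N * H N d j + j * H N d (suc j)

H-zero : ∀ N d → H N d 0 ≡ N ^ d
H-zero N zero    = refl
H-zero N (suc d) = trans (+-identityʳ _) (cong (N *_) (H-zero N d))

H-difference : ∀ N d j → H N (suc d) (suc j) ≡ H N (suc d) j + suc d * H N d (suc j)
H-difference N zero    j = regroup N j
  where
  regroup : ∀ N j → N * 1 + suc j * 1 ≡ (N * 1 + j * 1) + 1 * 1
  regroup = solve-∀
H-difference N (suc d) j = begin
    N * H N (suc d) (suc j) + suc j * H N (suc d) (suc (suc j))
  ≡⟨ cong₂ (λ x y → N * x + suc j * y) (H-difference N d j) (H-difference N d (suc j)) ⟩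
    N * (a + suc d * b) + suc j * ((N * b + suc j * c) + suc d * c)
  ≡⟨ regroup N j d a b c ⟩
    (N * a + j * (N * b + suc j * c)) + suc (suc d) * (N * b + suc j * c)
  ∎
  where
  open ≡-Reasoning
  a = H N (suc d) j
  b = H N d (suc j)
  c = H N d (suc (suc j))
  regroup : ∀ N j d a b c →
    N * (a + suc d * b) + suc j * ((N * b + suc j * c) + suc d * c) ≡
    (N * a + j * (N * b + suc j * c)) + suc (suc d) * (N * b + suc j * c)
  regroup = solve-∀

H-split : ∀ n d j → H (suc (n + d)) (suc d) j ≡
                    n * H (suc (n + d)) d (suc j) + suc j * H (suc (n + d)) d (suc (suc j))
H-split n d j = sym (+-cancelʳ-≡ (suc d * b) _ _ (begin
    n * b + suc j * c + suc d * b   ≡⟨ regroup n d j b c ⟩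
    H N (suc d) (suc j)             ≡⟨ H-difference N d j ⟩
    H N (suc d) j + suc d * b       ∎))
  where
  open ≡-Reasoning
  N = suc (n + d)
  b = H N d (suc j)
  c = H N d (suc (suc j))
  regroup : ∀ n d j b c → n * b + suc j * c + suc d * b ≡ suc (n + d) * b + suc j * c
  regroup = solve-∀

descendants : ℕ → ℕ → ℕ → ℕ
descendants n e zero    = 1
descendants n e (suc d) = n * descendants (suc n) (suc e) d + e * descendants (suc n) (suc (suc e)) d

descendants≡H : ∀ n j d → descendants n (suc j) d ≡ H (n + d) d j
descendants≡H n j zero    = refl
descendants≡H n j (suc d) = begin
    n * descendants (suc n) (suc (suc j)) d + suc j * descendants (suc n) (suc (suc (suc j))) d
  ≡⟨ cong₂ (λ x y → n * x + suc j * y)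
           (descendants≡H (suc n) (suc j) d) (descendants≡H (suc n) (suc (suc j)) d) ⟩
    n * H (suc (n + d)) d (suc j) + suc j * H (suc (n + d)) d (suc (suc j))
  ≡⟨ H-split n d j ⟨
    H (suc (n + d)) (suc d) j
  ≡⟨ cong (λ N → H N (suc d) j) (+-suc n d) ⟨
    H (n + suc d) (suc d) j
  ∎
  where open ≡-Reasoning

descendants-root : ∀ k → descendants 1 0 k ≡ suc k ^ (suc k ∸ 2)
descendants-root zero    = refl
descendants-root (suc d) = begin
    1 * descendants 2 1 d + 0   ≡⟨ trans (+-identityʳ _) (*-identityˡ _) ⟩
    descendants 2 1 d           ≡⟨ descendants≡H 2 0 d ⟩
    H (2 + d) d 0               ≡⟨ H-zero (2 + d) d ⟩
    (2 + d) ^ d                 ∎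
  where open ≡-Reasoning

-- Adjoining a last vertex

lookup-∷ʳ-inject₁ : ∀ {x : X} (xs : Vec X n) (i : Fin n) → lookup (xs ∷ʳ x) (inject₁ i) ≡ lookup xs i
lookup-∷ʳ-inject₁ (y ∷ xs) zero    = refl
lookup-∷ʳ-inject₁ (y ∷ xs) (suc i) = lookup-∷ʳ-inject₁ xs i

lookup-∷ʳ-fromℕ : ∀ {x : X} (xs : Vec X n) → lookup (xs ∷ʳ x) (fromℕ n) ≡ x
lookup-∷ʳ-fromℕ []       = refl
lookup-∷ʳ-fromℕ (y ∷ xs) = lookup-∷ʳ-fromℕ xs

data LastView : Fin (suc n) → Set where
  old : (i : Fin n) → LastView (inject₁ i)
  new : LastView (fromℕ n)

lastView : (i : Fin (suc n)) → LastView i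
lastView {zero}  zero    = new
lastView {suc n} zero    = old zero
lastView {suc n} (suc i) with lastView i
... | old j = old (suc j)
... | new   = new

inject₁<fromℕ : (i : Fin n) → inject₁ i < fromℕ n
inject₁<fromℕ {n} i = subst (toℕ (inject₁ i) ℕ.<_) (sym (toℕ-fromℕ n)) (inject₁ℕ< i)

inject₁-mono-< : {i j : Fin n} → i < j → inject₁ i < inject₁ j
inject₁-mono-< {i = i} {j} = subst₂ ℕ._<_ (sym (toℕ-inject₁ i)) (sym (toℕ-inject₁ j))

module _ (A : Adj n) (nb : Vec Bool n) where

  extend-old-row : ∀ u → lookup (extend A nb) (inject₁ u) ≡ lookup A u ∷ʳ lookup nb u
  extend-old-row u = trans (lookup-∷ʳ-inject₁ (zipWith _∷ʳ_ A nb) u) (lookup-zipWith _∷ʳ_ u A nb)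

  extend-new-row : lookup (extend A nb) (fromℕ n) ≡ nb ∷ʳ false
  extend-new-row = lookup-∷ʳ-fromℕ (zipWith _∷ʳ_ A nb)

  adj-extend-old-old : ∀ u v → adj (extend A nb) (inject₁ u) (inject₁ v) ≡ adj A u v
  adj-extend-old-old u v =
    trans (cong (λ r → lookup r (inject₁ v)) (extend-old-row u)) (lookup-∷ʳ-inject₁ (lookup A u) v)

  adj-extend-old-new : ∀ u → adj (extend A nb) (inject₁ u) (fromℕ n) ≡ lookup nb u
  adj-extend-old-new u =
    trans (cong (λ r → lookup r (fromℕ n)) (extend-old-row u)) (lookup-∷ʳ-fromℕ (lookup A u))

  adj-extend-new-old : ∀ v → adj (extend A nb) (fromℕ n) (inject₁ v) ≡ lookup nb v
  adj-extend-new-old v = trans (cong (λ r → lookup r (inject₁ v)) extend-new-row) (lookup-∷ʳ-inject₁ nb v)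

  adj-extend-new-new : adj (extend A nb) (fromℕ n) (fromℕ n) ≡ false
  adj-extend-new-new = trans (cong (λ r → lookup r (fromℕ n)) extend-new-row) (lookup-∷ʳ-fromℕ nb)

zipWith-∷ʳ-injectiveˡ : ∀ {m k} (rs ss : Vec (Vec X m) k) (xs ys : Vec X k) →
                        zipWith _∷ʳ_ rs xs ≡ zipWith _∷ʳ_ ss ys → rs ≡ ss
zipWith-∷ʳ-injectiveˡ []       []       []       []       _  = refl
zipWith-∷ʳ-injectiveˡ (r ∷ rs) (s ∷ ss) (x ∷ xs) (y ∷ ys) eq =
  let head≡ , tail≡ = ∷-injective eq
  in cong₂ _∷_ (∷ʳ-injectiveˡ r s head≡) (zipWith-∷ʳ-injectiveˡ rs ss xs ys tail≡)

extend-injective : {A B : Adj n} {nb nb′ : Vec Bool n} → extend A nb ≡ extend B nb′ → A ≡ B × nb ≡ nb′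
extend-injective {A = A} {B} {nb} {nb′} eq =
  let rows≡ , last≡ = ∷ʳ-injective _ _ eq
  in zipWith-∷ʳ-injectiveˡ A B nb nb′ rows≡ , ∷ʳ-injectiveˡ nb nb′ last≡

Enumerates : List (Fin n) → Vec Bool n → Set
Enumerates ws nb = ∀ x → lookup nb x ≡ true ⇔ x ∈ ws

single-enumerates : (v : Fin n) → Enumerates (v ∷ []) (single v)
single-enumerates v x rewrite lookup∘tabulate (λ w → ⌊ w ≟ v ⌋) x with x ≟ v
... | yes refl = mk⇔ (λ _ → here refl) (λ _ → refl)
... | no x≢v   = mk⇔ (λ ()) (λ { (here x≡v) → contradiction x≡v x≢v })

pair-enumerates : (u v : Fin n) → Enumerates (u ∷ v ∷ []) (pair u v)
pair-enumerates u v x rewrite lookup∘tabulate (λ w → ⌊ w ≟ u ⌋ ∨ ⌊ w ≟ v ⌋) x with x ≟ u | x ≟ v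
... | yes refl | _        = mk⇔ (λ _ → here refl) (λ _ → refl)
... | no _     | yes refl = mk⇔ (λ _ → there (here refl)) (λ _ → refl)
... | no x≢u   | no x≢v   =
  mk⇔ (λ ()) (λ { (here x≡u) → contradiction x≡u x≢u ; (there (here x≡v)) → contradiction x≡v x≢v })

enumerates-⊆ : ∀ {ws ws′ : List (Fin n)} {nb nb′ x} →
               Enumerates ws nb → Enumerates ws′ nb′ → nb ≡ nb′ → x ∈ ws → x ∈ ws′
enumerates-⊆ enum enum′ refl x∈ws = to (enum′ _) (from (enum _) x∈ws)

pair-comm : (u v : Fin n) → pair u v ≡ pair v u
pair-comm u v = tabulate-cong (λ w → ∨-comm ⌊ w ≟ u ⌋ ⌊ w ≟ v ⌋)

single-injective : {v w : Fin n} → single v ≡ single w → v ≡ w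
single-injective {v = v} {w} eq
  with here v≡w ← enumerates-⊆ (single-enumerates v) (single-enumerates w) eq (here refl)
  = v≡w

single≢pair : {u v w : Fin n} → u < w → single v ≢ pair u w
single≢pair {u = u} {v} {w} u<w eq
  with enumerates-⊆ (pair-enumerates u w) (single-enumerates v) (sym eq) (here refl)
     | enumerates-⊆ (pair-enumerates u w) (single-enumerates v) (sym eq) (there (here refl))
... | here refl | here refl = <⇒≢ u<w refl

pair-injective : {u v u′ v′ : Fin n} → u < v → u′ < v′ → pair u v ≡ pair u′ v′ → (u , v) ≡ (u′ , v′)
pair-injective {u = u} {v} {u′} {v′} u<v u′<v′ eq
  with enumerates-⊆ (pair-enumerates u v) (pair-enumerates u′ v′) eq (here refl)
     | enumerates-⊆ (pair-enumerates u v) (pair-enumerates u′ v′) eq (there (here refl))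
     | enumerates-⊆ (pair-enumerates u′ v′) (pair-enumerates u v) (sym eq) (here refl)
... | here refl         | here refl         | _                 = contradiction refl (<⇒≢ u<v)
... | here refl         | there (here refl) | _                 = refl
... | there (here refl) | _                 | here refl         = contradiction refl (<⇒≢ u′<v′)
... | there (here refl) | _                 | there (here refl) = contradiction u′<v′ (<-asym u<v)

unique-map⁺ : {f : X → Y} {xs : List X} →
              (∀ {x y} → x ∈ xs → y ∈ xs → f x ≡ f y → x ≡ y) → Unique xs → Unique (map f xs)
unique-map⁺ {xs = []}     _   []            = []
unique-map⁺ {xs = x ∷ xs} inj (x∉xs ∷ xs!) =
  All.map⁺ (All.tabulate λ y∈xs fx≡fy → All.lookup x∉xs y∈xs (inj (here refl) (there y∈xs) fx≡fy))
  ∷ unique-map⁺ (λ x∈ y∈ → inj (there x∈) (there y∈)) xs!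

-- Trees with edge lists

Edge : ℕ → Set
Edge n = Fin n × Fin n

record Tree (n : ℕ) : Set where
  constructor tree
  field
    graph : Adj n
    edges : List (Edge n)
open Tree

newEdge : Fin n → Edge (suc n)
newEdge {n} w = inject₁ w , fromℕ n

raise : Edge n → Edge (suc n)
raise (u , v) = inject₁ u , inject₁ v

attach : Tree n → Vec Bool n → List (Fin n) → Tree (suc n)
attach t nb ws = tree (extend (graph t) nb) (map newEdge ws ++ map raise (edges t))

attachToVertex : Tree n → Fin n → Tree (suc n)
attachToVertex t v = attach t (single v) (v ∷ [])

attachToEdge : Tree n → Edge n → Tree (suc n)
attachToEdge t (u , w) = attach t (pair u w) (u ∷ w ∷ [])

children : Tree n → List (Tree (suc n))
children {n} t = map (attachToVertex t) (allFin n) ++ map (attachToEdge t) (edges t)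

trees : (k : ℕ) → List (Tree (suc k))
trees zero    = tree ((false ∷ []) ∷ []) [] ∷ []
trees (suc k) = concatMap children (trees k)

record Valid (t : Tree n) : Set where
  field
    increasing : Inc12 n (graph t)
    adjacent   : ∀ {u v} → (u , v) ∈ edges t → adj (graph t) u v ≡ true
    oriented   : ∀ {u v} → (u , v) ∈ edges t → u < v
    complete   : ∀ u v → adj (graph t) u v ≡ true → (u , v) ∈ edges t ⊎ (v , u) ∈ edges t
    distinct   : Unique (edges t)
open Valid

∈-attach⁻ : ∀ {e} (t : Tree n) nb ws → e ∈ edges (attach t nb ws) →
            (∃ λ w → w ∈ ws × e ≡ newEdge w) ⊎ (∃ λ e′ → e′ ∈ edges t × e ≡ raise e′)
∈-attach⁻ t nb ws e∈ = Sum.map (∈-map⁻ newEdge) (∈-map⁻ raise) (∈-++⁻ (map newEdge ws) e∈)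

attach-valid : {t : Tree n} {nb : Vec Bool n} {ws : List (Fin n)} →
               Valid t → Inc12 (suc n) (extend (graph t) nb) → Unique ws → Enumerates ws nb →
               Valid (attach t nb ws)
attach-valid {n} {t} {nb} {ws} valid inc ws! enum = record
  { increasing = inc ; adjacent = adjacent′ ; oriented = oriented′ ; complete = complete′ ; distinct = distinct′ }
  where
  A = graph t
  E′ = edges (attach t nb ws)

  adjacent′ : ∀ {x y} → (x , y) ∈ E′ → adj (extend A nb) x y ≡ true
  adjacent′ xy∈ with ∈-attach⁻ t nb ws xy∈
  ... | inj₁ (w , w∈ws , refl)       = trans (adj-extend-old-new A nb w) (from (enum w) w∈ws)
  ... | inj₂ ((u , v) , uv∈E , refl) = trans (adj-extend-old-old A nb u v) (adjacent valid uv∈E)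

  oriented′ : ∀ {x y} → (x , y) ∈ E′ → x < y
  oriented′ xy∈ with ∈-attach⁻ t nb ws xy∈
  ... | inj₁ (w , _ , refl)          = inject₁<fromℕ w
  ... | inj₂ ((u , v) , uv∈E , refl) = inject₁-mono-< (oriented valid uv∈E)

  new∈ : ∀ {w} → w ∈ ws → newEdge w ∈ E′
  new∈ w∈ws = ∈-++⁺ˡ (∈-map⁺ newEdge w∈ws)

  old∈ : ∀ {e} → e ∈ edges t → raise e ∈ E′
  old∈ e∈E = ∈-++⁺ʳ (map newEdge ws) (∈-map⁺ raise e∈E)

  complete′ : ∀ x y → adj (extend A nb) x y ≡ true → (x , y) ∈ E′ ⊎ (y , x) ∈ E′
  complete′ x y xy with lastView x | lastView y
  ... | old u | old v = Sum.map old∈ old∈ (complete valid u v (trans (sym (adj-extend-old-old A nb u v)) xy))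
  ... | old u | new   = inj₁ (new∈ (to (enum u) (trans (sym (adj-extend-old-new A nb u)) xy)))
  ... | new   | old v = inj₂ (new∈ (to (enum v) (trans (sym (adj-extend-new-old A nb v)) xy)))
  ... | new   | new   = contradiction (trans (sym (adj-extend-new-new A nb)) xy) λ ()

  raise-injective : ∀ {e e′} → raise e ≡ raise e′ → e ≡ e′
  raise-injective eq = cong₂ _,_ (inject₁-injective (cong proj₁ eq)) (inject₁-injective (cong proj₂ eq))

  new∉old : Disjoint (map newEdge ws) (map raise (edges t))
  new∉old (p , q) with ∈-map⁻ newEdge p | ∈-map⁻ raise q
  ... | _ , _ , refl | _ , _ , eq = fromℕ≢inject₁ (cong proj₂ eq)

  distinct′ : Unique E′
  distinct′ = ++⁺ (map⁺ (inject₁-injective ∘ cong proj₁) ws!) (map⁺ raise-injective (distinct valid)) new∉old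

children-valid : {t : Tree n} → Valid t → All Valid (children t)
children-valid {n} {t} valid =
  All.++⁺ (All.map⁺ (All.tabulate λ {v} _ → vertex-child v)) (All.map⁺ (All.tabulate edge-child))
  where
  vertex-child : (v : Fin n) → Valid (attachToVertex t v)
  vertex-child v = attach-valid valid (onVertex (increasing valid) v) ([] ∷ []) (single-enumerates v)

  edge-child : ∀ {e} → e ∈ edges t → Valid (attachToEdge t e)
  edge-child {u , w} uw∈E =
    attach-valid valid (onEdge (increasing valid) u w (adjacent valid uw∈E))
                 ((<⇒≢ (oriented valid uw∈E) ∷ []) ∷ [] ∷ []) (pair-enumerates u w)

trees-valid : ∀ k → All Valid (trees k)
trees-valid zero    = base-valid ∷ []
  where
  base-valid : Valid (tree ((false ∷ []) ∷ []) [])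
  base-valid = record
    { increasing = base ; adjacent = λ () ; oriented = λ () ; complete = λ { zero zero () } ; distinct = [] }
trees-valid (suc k) = All.concat⁺ (All.map⁺ (All.map children-valid (trees-valid k)))

-- Every tree is generated exactly once

graphs-children : (t : Tree n) → map graph (children t) ≡
  map (extend (graph t) ∘ single) (allFin n) ++ map (extend (graph t) ∘ uncurry pair) (edges t)
graphs-children {n} t = trans (map-++ graph (map (attachToVertex t) (allFin n)) _)
                              (cong₂ _++_ (sym (map-∘ (allFin n))) (sym (map-∘ (edges t))))

∈-graphs-children⁻ : ∀ {G} (t : Tree n) → G ∈ map graph (children t) → ∃ λ nb → G ≡ extend (graph t) nb
∈-graphs-children⁻ {n} t G∈
  with ∈-++⁻ (map (extend (graph t) ∘ single) (allFin n)) (subst (_ ∈_) (graphs-children t) G∈)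
... | inj₁ p = let v , _ , G≡ = ∈-map⁻ _ p in single v , G≡
... | inj₂ p = let e , _ , G≡ = ∈-map⁻ _ p in uncurry pair e , G≡

graphs-children-unique : {t : Tree n} → Valid t → Unique (map graph (children t))
graphs-children-unique {n} {t} valid =
  subst Unique (sym (graphs-children t)) (++⁺ vertex-children edge-children different-kinds)
  where
  vertex-children : Unique (map (extend (graph t) ∘ single) (allFin n))
  vertex-children = map⁺ (single-injective ∘ proj₂ ∘ extend-injective) (allFin⁺ n)

  edge-children : Unique (map (extend (graph t) ∘ uncurry pair) (edges t))
  edge-children = unique-map⁺
    (λ e∈ e′∈ → pair-injective (oriented valid e∈) (oriented valid e′∈) ∘ proj₂ ∘ extend-injective)
    (distinct valid)

  different-kinds : Disjoint (map (extend (graph t) ∘ single) (allFin n))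
                             (map (extend (graph t) ∘ uncurry pair) (edges t))
  different-kinds (p , q) with ∈-map⁻ _ p | ∈-map⁻ _ q
  ... | _ , _ , refl | _ , uw∈E , eq = single≢pair (oriented valid uw∈E) (proj₂ (extend-injective eq))

graphs-concatMap-children-unique : {L : List (Tree n)} → All Valid L → Unique (map graph L) →
                                   Unique (map graph (concatMap children L))
graphs-concatMap-children-unique [] [] = []
graphs-concatMap-children-unique {L = t ∷ L} (valid ∷ valids) (t∉L ∷ L!) =
  subst Unique (sym (map-++ graph (children t) (concatMap children L)))
    (++⁺ (graphs-children-unique valid) (graphs-concatMap-children-unique valids L!) different-parents)
  where
  different-parents : Disjoint (map graph (children t)) (map graph (concatMap children L))
  different-parents (p , q)
    with t′ , t′∈L , q′ ← find (∈-concatMap⁻ (map graph ∘ children)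
                                 (subst (_ ∈_) (map-concatMap graph children L) q))
    with nb , refl ← ∈-graphs-children⁻ t p
    with nb′ , eq ← ∈-graphs-children⁻ t′ q′
    = All.lookup t∉L (∈-map⁺ graph t′∈L) (proj₁ (extend-injective eq))

graphs-trees-unique : ∀ k → Unique (map graph (trees k))
graphs-trees-unique zero    = [] ∷ []
graphs-trees-unique (suc k) = graphs-concatMap-children-unique (trees-valid k) (graphs-trees-unique k)

∈-graphs-trees⁻ : ∀ {k A} → A ∈ map graph (trees k) → Inc12 (suc k) A
∈-graphs-trees⁻ {k} A∈ with t , t∈ , refl ← ∈-map⁻ graph A∈ = increasing (All.lookup (trees-valid k) t∈)

attachToVertex-∈-children : (t : Tree n) (v : Fin n) → attachToVertex t v ∈ children t
attachToVertex-∈-children t v = ∈-++⁺ˡ (∈-map⁺ (attachToVertex t) (∈-allFin v))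

attachToEdge-∈-children : (t : Tree n) {e : Edge n} → e ∈ edges t → attachToEdge t e ∈ children t
attachToEdge-∈-children {n} t e∈E = ∈-++⁺ʳ (map (attachToVertex t) (allFin n)) (∈-map⁺ (attachToEdge t) e∈E)

graph-child-∈-trees : ∀ {k} {t : Tree (suc k)} {c} →
                      t ∈ trees k → c ∈ children t → graph c ∈ map graph (trees (suc k))
graph-child-∈-trees t∈ c∈ = ∈-map⁺ graph (∈-concatMap⁺ children (lose t∈ c∈))

∈-graphs-trees⁺ : ∀ {k A} → Inc12 (suc k) A → A ∈ map graph (trees k)
∈-graphs-trees⁺ base = here refl
∈-graphs-trees⁺ (onVertex {zero} _ ())
∈-graphs-trees⁺ (onVertex {suc k} d v) with t , t∈ , refl ← ∈-map⁻ graph (∈-graphs-trees⁺ d) =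
  graph-child-∈-trees t∈ (attachToVertex-∈-children t v)
∈-graphs-trees⁺ (onEdge {zero} _ () _ _)
∈-graphs-trees⁺ (onEdge {suc k} d u w uw) with t , t∈ , refl ← ∈-map⁻ graph (∈-graphs-trees⁺ d)
  with complete (All.lookup (trees-valid k) t∈) u w uw
... | inj₁ uw∈E = graph-child-∈-trees t∈ (attachToEdge-∈-children t uw∈E)
... | inj₂ wu∈E = subst (_∈ map graph (trees (suc k))) (cong (extend (graph t)) (pair-comm w u))
                        (graph-child-∈-trees t∈ (attachToEdge-∈-children t wu∈E))

-- Counting the generated trees

descendantsOf : ℕ → Tree n → ℕ
descendantsOf {n} d t = descendants n (length (edges t)) d

sum-map-const : {f : X → ℕ} {c : ℕ} (xs : List X) → (∀ x → f x ≡ c) → sum (map f xs) ≡ length xs * c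
sum-map-const []       _   = refl
sum-map-const (x ∷ xs) f≡c = cong₂ _+_ (f≡c x) (sum-map-const xs f≡c)

children-descendants : ∀ d (t : Tree n) → sum (map (descendantsOf d) (children t)) ≡ descendantsOf (suc d) t
children-descendants {n} d t = begin
    sum (map (descendantsOf d) (map vertexChild (allFin n) ++ map edgeChild (edges t)))
  ≡⟨ cong sum (map-++ (descendantsOf d) (map vertexChild (allFin n)) _) ⟩
    sum (map (descendantsOf d) (map vertexChild (allFin n)) ++ map (descendantsOf d) (map edgeChild (edges t)))
  ≡⟨ sum-++ (map (descendantsOf d) (map vertexChild (allFin n))) _ ⟩
    sum (map (descendantsOf d) (map vertexChild (allFin n))) + sum (map (descendantsOf d) (map edgeChild (edges t)))
  ≡⟨ cong₂ _+_ (cong sum (sym (map-∘ (allFin n)))) (cong sum (sym (map-∘ (edges t)))) ⟩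
    sum (map (descendantsOf d ∘ vertexChild) (allFin n)) + sum (map (descendantsOf d ∘ edgeChild) (edges t))
  ≡⟨ cong₂ _+_ (sum-map-const (allFin n) λ _ → cong (λ m → descendants (suc n) (suc m) d) raised)
               (sum-map-const (edges t) λ _ → cong (λ m → descendants (suc n) (suc (suc m)) d) raised) ⟩
    length (allFin n) * descendants (suc n) (suc e) d + e * descendants (suc n) (suc (suc e)) d
  ≡⟨ cong (λ m → m * descendants (suc n) (suc e) d + e * descendants (suc n) (suc (suc e)) d)
          (length-tabulate {n = n} (λ i → i)) ⟩
    descendantsOf (suc d) t
  ∎
  where
  open ≡-Reasoning
  vertexChild = attachToVertex t
  edgeChild = attachToEdge t
  e = length (edges t)
  raised : length (map raise (edges t)) ≡ e
  raised = length-map raise (edges t)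

concatMap-children-descendants : ∀ d (L : List (Tree n)) →
  sum (map (descendantsOf d) (concatMap children L)) ≡ sum (map (descendantsOf (suc d)) L)
concatMap-children-descendants d []      = refl
concatMap-children-descendants d (t ∷ L) = begin
    sum (map (descendantsOf d) (children t ++ concatMap children L))
  ≡⟨ cong sum (map-++ (descendantsOf d) (children t) (concatMap children L)) ⟩
    sum (map (descendantsOf d) (children t) ++ map (descendantsOf d) (concatMap children L))
  ≡⟨ sum-++ (map (descendantsOf d) (children t)) _ ⟩
    sum (map (descendantsOf d) (children t)) + sum (map (descendantsOf d) (concatMap children L))
  ≡⟨ cong₂ _+_ (children-descendants d t) (concatMap-children-descendants d L) ⟩
    descendantsOf (suc d) t + sum (map (descendantsOf (suc d)) L)
  ∎
  where open ≡-Reasoning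

trees-descendants : ∀ k d → sum (map (descendantsOf d) (trees k)) ≡ descendants 1 0 (k + d)
trees-descendants zero    d = +-identityʳ _
trees-descendants (suc k) d = begin
    sum (map (descendantsOf d) (concatMap children (trees k)))  ≡⟨ concatMap-children-descendants d (trees k) ⟩
    sum (map (descendantsOf (suc d)) (trees k))                 ≡⟨ trees-descendants k (suc d) ⟩
    descendants 1 0 (k + suc d)                                 ≡⟨ cong (descendants 1 0) (+-suc k d) ⟩
    descendants 1 0 (suc k + d)                                 ∎
  where open ≡-Reasoning

length-trees : ∀ k → length (trees k) ≡ descendants 1 0 k
length-trees k = begin
    length (trees k)                       ≡⟨ *-identityʳ _ ⟨
    length (trees k) * 1                   ≡⟨ sum-map-const (trees k) (λ _ → refl) ⟨
    sum (map (descendantsOf 0) (trees k))  ≡⟨ trees-descendants k 0 ⟩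
    descendants 1 0 (k + 0)                ≡⟨ cong (descendants 1 0) (+-identityʳ k) ⟩
    descendants 1 0 k                      ∎
  where open ≡-Reasoning

corollary1 : (n : ℕ) → 1 ≤ n →
    Σ (List (Adj n)) (λ Ts →
      Unique Ts × length Ts ≡ n ^ (n ∸ 2) × ((A : Adj n) → Inc12 n A ⇔ A ∈ Ts))
corollary1 zero    ()
corollary1 (suc k) _ =
  map graph (trees k) ,
  graphs-trees-unique k ,
  trans (length-map graph (trees k)) (trans (length-trees k) (descendants-root k)) ,
  λ A → mk⇔ ∈-graphs-trees⁺ ∈-graphs-trees⁻
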